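{- Let $G$ be a rigid graph having a dominating vertex $v$. Then the induced subgraph of $G$ on $V(G)\setminus\{v\}$ is also rigid.
   Context: All graphs are finite and simple. A graph is rigid if its only automorphism is the identity. A dominating vertex of $G$ is a vertex of degree $|V(G)|-1$. -}

module Defs where

open import Data.Nat using (ℕ; suc)
open import Data.Fin using (Fin; punchIn)
open import Data.Bool using (Bool; true; false)
open import Data.Product using (_×_)
open import Relation.Binary.PropositionalEquality using (_≡_; _≢_)
open import Function.Bundles using (_↔_; Inverse)

record Graph (n : ℕ) : Set where
  field
    adj   : Fin n → Fin n → Bool
    sym   : ∀ x y → adj x y ≡ adj y x
    irrefl : ∀ x → adj x x ≡ false
open Graph public

record Automorphism {n : ℕ} (G : Graph n) : Set where
  field
    perm     : Fin n ↔ Fin n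
    preserve : ∀ x y → adj G (Inverse.to perm x) (Inverse.to perm y) ≡ adj G x y
open Automorphism public

Rigid : {n : ℕ} → Graph n → Set
Rigid {n} G = (σ : Automorphism G) → ∀ x → Inverse.to (perm σ) x ≡ x

Dominating : {n : ℕ} → Graph n → Fin n → Set
Dominating G v = ∀ x → x ≢ v → adj G v x ≡ true

-- Induced subgraph on V(G) \ {v}, with vertices Fin n' identified with
-- Fin (suc n') minus v via punchIn v.
deleteVertex : {n : ℕ} → Graph (suc n) → Fin (suc n) → Graph n
deleteVertex G v = record
  { adj = λ x y → adj G (punchIn v x) (punchIn v y)
  ; sym = λ x y → sym G (punchIn v x) (punchIn v y)
  ; irrefl = λ x → irrefl G (punchIn v x)
  }

module Submission where

-- Let v be a dominating vertex of G and σ an automorphism of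
-- G - v (whose vertices are identified with V(G) \ {v} through punchIn v).
-- Extending σ by fixing v gives a permutation σ⁺ of V(G).  It preserves
-- adjacency: between two vertices other than v this is σ being an
-- automorphism of G - v, and any pair involving v (but not twice) is an
-- edge both before and after applying σ⁺, because v is dominating.  So σ⁺
-- is an automorphism of G, hence the identity by rigidity of G, and then
-- σ itself is the identity since punchIn v is injective.

open import Defs
open import Data.Nat using (ℕ; suc)
open import Data.Fin using (Fin; punchIn; punchOut)
open import Data.Fin.Properties
  using (_≟_; punchIn-punchOut; punchOut-punchIn; punchOut-cong; punchInᵢ≢i; punchIn-injective)
open import Data.Empty using (⊥-elim)
open import Relation.Nullary using (yes; no)
open import Relation.Binary.PropositionalEquality
  using (_≡_; refl; cong; cong₂; subst; module ≡-Reasoning)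
  renaming (sym to ≡-sym; trans to ≡-trans)
open import Function.Bundles using (_↔_; Inverse; mk↔ₛ′)

module Extension {n : ℕ} (v : Fin (suc n)) where

  data VertexView : Fin (suc n) → Set where
    is-v      : VertexView v
    is-other  : (z : Fin n) → VertexView (punchIn v z)

  vertexView : (y : Fin (suc n)) → VertexView y
  vertexView y with v ≟ y
  ... | yes refl = is-v
  ... | no v≢y   = subst VertexView (punchIn-punchOut v≢y) (is-other (punchOut v≢y))

  extend : (Fin n → Fin n) → Fin (suc n) → Fin (suc n)
  extend f y with v ≟ y
  ... | yes _    = v
  ... | no v≢y   = punchIn v (f (punchOut v≢y))

  extend-v : (f : Fin n → Fin n) → extend f v ≡ v
  extend-v f with v ≟ v
  ... | yes _    = refl
  ... | no v≢v   = ⊥-elim (v≢v refl)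

  extend-punchIn : (f : Fin n → Fin n) (z : Fin n) →
                   extend f (punchIn v z) ≡ punchIn v (f z)
  extend-punchIn f z with v ≟ punchIn v z
  ... | yes v≡z⁺ = ⊥-elim (punchInᵢ≢i v z (≡-sym v≡z⁺))
  ... | no v≢z⁺  = cong (λ w → punchIn v (f w)) punchOut-z⁺≡z
    where
    punchOut-z⁺≡z : punchOut v≢z⁺ ≡ z
    punchOut-z⁺≡z = ≡-trans (punchOut-cong v {i≢k = λ e → punchInᵢ≢i v z (≡-sym e)} refl)
                            (punchOut-punchIn v)

  extend-inverse : (f g : Fin n → Fin n) → (∀ z → f (g z) ≡ z) →
                   ∀ y → extend f (extend g y) ≡ y
  extend-inverse f g f∘g≡id y with vertexView y
  ... | is-v = ≡-trans (cong (extend f) (extend-v g)) (extend-v f)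
  ... | is-other z = begin
      extend f (extend g (punchIn v z))   ≡⟨ cong (extend f) (extend-punchIn g z) ⟩
      extend f (punchIn v (g z))          ≡⟨ extend-punchIn f (g z) ⟩
      punchIn v (f (g z))                 ≡⟨ cong (punchIn v) (f∘g≡id z) ⟩
      punchIn v z                         ∎
    where open ≡-Reasoning

  extendPerm : Fin n ↔ Fin n → Fin (suc n) ↔ Fin (suc n)
  extendPerm π = mk↔ₛ′ (extend to) (extend from)
    (extend-inverse to from (Inverse.strictlyInverseˡ π))
    (extend-inverse from to (Inverse.strictlyInverseʳ π))
    where open Inverse π using (to; from)

open Extension

dominating-uniform : {n : ℕ} (G : Graph (suc n)) (v : Fin (suc n)) →
                     Dominating G v → (z w : Fin n) →
                     adj G v (punchIn v z) ≡ adj G v (punchIn v w)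
dominating-uniform G v dom z w =
  ≡-trans (dom (punchIn v z) (punchInᵢ≢i v z)) (≡-sym (dom (punchIn v w) (punchInᵢ≢i v w)))

extendAutomorphism : {n : ℕ} (G : Graph (suc n)) (v : Fin (suc n)) →
                     Dominating G v → Automorphism (deleteVertex G v) → Automorphism G
extendAutomorphism G v dom σ = record { perm = extendPerm v (perm σ) ; preserve = preserves }
  where
  f : Fin _ → Fin _
  f = Inverse.to (perm σ)

  preserves : ∀ a b → adj G (extend v f a) (extend v f b) ≡ adj G a b
  preserves a b with vertexView v a | vertexView v b
  ... | is-v | is-v =
    cong₂ (adj G) (extend-v v f) (extend-v v f)
  ... | is-v | is-other w =
    ≡-trans (cong₂ (adj G) (extend-v v f) (extend-punchIn v f w))
            (dominating-uniform G v dom (f w) w)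
  ... | is-other z | is-v = begin
    adj G (extend v f (punchIn v z)) (extend v f v)  ≡⟨ cong₂ (adj G) (extend-punchIn v f z) (extend-v v f) ⟩
    adj G (punchIn v (f z)) v                        ≡⟨ sym G _ _ ⟩
    adj G v (punchIn v (f z))                        ≡⟨ dominating-uniform G v dom (f z) z ⟩
    adj G v (punchIn v z)                            ≡⟨ sym G _ _ ⟩
    adj G (punchIn v z) v                            ∎
    where open ≡-Reasoning
  ... | is-other z | is-other w =
    ≡-trans (cong₂ (adj G) (extend-punchIn v f z) (extend-punchIn v f w))
            (preserve σ z w)

-- The extension of σ is the identity by rigidity of G, so σ
-- is the identity because punchIn v is injective.
proposition3p2 : (n : ℕ) (G : Graph (suc n)) (v : Fin (suc n)) →
    Rigid G → Dominating G v → Rigid (deleteVertex G v)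
proposition3p2 n G v rigid dom σ x = punchIn-injective v _ _ (begin
  punchIn v (f x)          ≡⟨ ≡-sym (extend-punchIn v f x) ⟩
  extend v f (punchIn v x) ≡⟨ rigid (extendAutomorphism G v dom σ) (punchIn v x) ⟩
  punchIn v x              ∎)
  where
  open ≡-Reasoning
  f : Fin n → Fin n
  f = Inverse.to (perm σ)
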